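{- Let $a,b$ be positive integers with $2\le a<b$, and write $b=ka+r$ with $k$ odd and $0<r<a$. Then the subtraction set of the subtraction game $\mathcal{S}(a,b,a+b)$ has expansion \[\big(\{sa: s\text{ odd},\ s\le k\}\cup\{ka+1,ka+2,\ldots,b+a\}\cup\{b+sa: s\text{ odd},\ s\le k\}\big)^{*(b+(k+1)a)}.\]
   Context: For a finite set $S$ of positive integers, the subtraction game $\mathcal{S}(S)$ is played on a single pile: two players alternately remove $s\in S$ coins (at most the pile size); the last mover wins. The nim-value is $\mathcal{G}(n)=\operatorname{mex}\{\mathcal{G}(n-s): s\in S, s\le n\}$. The expansion of $S$ is $S^{ex}=\{s\ge1:\mathcal{G}(n+s)\ne\mathcal{G}(n)\ \forall n\ge0\}$; "has expansion $T$" means $S^{ex}=T$. For a set $X$ and $p\ge1$, $X^{*p}=\{x+mp:x\in X,m\ge0\}$. -}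

module Defs where

open import Data.Nat using (ℕ; zero; suc; _+_; _*_; _∸_; _≤_; _<_)
open import Data.Nat.Properties using (_≟_)
open import Data.List using (List; []; _∷_; length; mapMaybe)
open import Data.List.Membership.DecPropositional _≟_ using (_∈?_)
open import Data.Maybe using (Maybe; just; nothing)
open import Data.Product using (Σ; ∃; _×_; _,_)
open import Data.Sum using (_⊎_)
open import Relation.Nullary using (¬_; yes; no)
open import Relation.Binary.PropositionalEquality using (_≡_)

mexAux : ℕ → ℕ → List ℕ → ℕ
mexAux zero    m l = m
mexAux (suc f) m l with m ∈? l
... | yes _ = mexAux f (suc m) l
... | no  _ = m

mex : List ℕ → ℕ
mex l = mexAux (length l) 0 l

index : List ℕ → ℕ → Maybe ℕ
index []       _       = nothing
index (x ∷ xs) zero    = just x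
index (x ∷ xs) (suc i) = index xs i

-- table S n = [ G(n-1) , G(n-2) , ... , G(0) ]
-- The option G(n - s) for s ∈ S with 1 ≤ s ≤ n sits at index (s - 1);
-- moves s = 0 are illegal/ignored and s > n gives nothing.
options : List ℕ → List ℕ → List ℕ
options S t = mapMaybe pick S
  where
  pick : ℕ → Maybe ℕ
  pick zero    = nothing
  pick (suc i) = index t i

table : List ℕ → ℕ → List ℕ
table S zero    = []
table S (suc n) = mex (options S (table S n)) ∷ table S n

G : List ℕ → ℕ → ℕ
G S n = mex (options S (table S n))

InExpansion : List ℕ → ℕ → Set
InExpansion S s = 1 ≤ s × (∀ n → ¬ (G S (n + s) ≡ G S n))

Star : (ℕ → Set) → ℕ → ℕ → Set
Star X p y = Σ ℕ λ x → Σ ℕ λ m → X x × y ≡ x + m * p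

Odd : ℕ → Set
Odd n = Σ ℕ λ j → n ≡ suc (2 * j)

Base : ℕ → ℕ → ℕ → ℕ → Set
Base a b k x =
    (Σ ℕ λ s → Odd s × s ≤ k × x ≡ s * a)
  ⊎ (k * a + 1 ≤ x × x ≤ b + a)
  ⊎ (Σ ℕ λ s → Odd s × s ≤ k × x ≡ b + s * a)

module Submission where

-- The proof writes the nim sequence down explicitly.

open import Defs
open import Data.Nat using (ℕ; zero; suc; parity; _+_; _*_; _∸_; _≤_; _<_; z≤n; s≤s; _<?_; _/_; _%_)
open import Data.Nat using (NonZero; >-nonZero; >-nonZero⁻¹)
open import Data.Nat.DivMod using (m≡m%n+[m/n]*n; m%n<n; [m+kn]%n≡m%n; m<n⇒m%n≡m)
open import Data.Nat.DivMod using (+-distrib-/-∣ˡ; m*n/n≡m; m<n⇒m/n≡0)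
open import Data.Nat.Divisibility using (divides)
open import Data.Nat.Tactic.RingSolver using (solve)
open import Data.Nat.Properties
open import Data.Parity.Base using (Parity; 0ℙ; 1ℙ; _⁻¹)
import Data.Parity.Properties as ℙ
open import Data.List using (List; []; _∷_; length; mapMaybe)
open import Data.List.Relation.Unary.Any using (here; there)
open import Data.List.Membership.Propositional using (_∈_; _∉_)
open import Data.Maybe using (Maybe; just; nothing)
open import Data.Maybe.Properties using (just-injective)
open import Function using (_∘_; case_of_; _⇔_; mk⇔; Equivalence)
open import Data.Product using (Σ; _×_; _,_)
open import Data.Sum using (_⊎_; inj₁; inj₂)
open import Data.Empty using (⊥-elim)
open import Relation.Nullary using (¬_; yes; no)
open import Relation.Binary.PropositionalEquality

open import Data.List.Membership.DecPropositional _≟_ using (_∈?_)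

split : ∀ x y → x < y ⊎ Σ ℕ λ z → x ≡ y + z
split x y with x <? y
... | yes x<y = inj₁ x<y
... | no x≮y with m≤n⇒∃[o]m+o≡n (≮⇒≥ x≮y)
...   | z , y+z≡x = inj₂ (z , sym y+z≡x)

transfer : ∀ {A B C D} → A ≡ B → C + B ≡ D + A → C ≡ D
transfer {A} {B} {C} {D} refl C+B≡D+B = +-cancelʳ-≡ B C D C+B≡D+B

remove : ∀ {x : ℕ} l → x ∈ l →
  Σ (List ℕ) λ l' → length l ≡ suc (length l') × (∀ w → w ∈ l → w ≢ x → w ∈ l')
remove (y ∷ ys) (here refl) = ys , refl , keep
  where
  keep : ∀ w → w ∈ y ∷ ys → w ≢ y → w ∈ ys
  keep w (here w≡y) w≢y = ⊥-elim (w≢y w≡y)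
  keep w (there w∈ys) _ = w∈ys
remove {x} (y ∷ ys) (there x∈ys) with remove ys x∈ys
... | l' , len , rest = y ∷ l' , cong suc len , keep
  where
  keep : ∀ w → w ∈ y ∷ ys → w ≢ x → w ∈ y ∷ l'
  keep w (here w≡y) _ = here w≡y
  keep w (there w∈ys) w≢x = there (rest w w∈ys w≢x)

covering-length : ∀ v l → (∀ w → w < v → w ∈ l) → v ≤ length l
covering-length zero    l covers = z≤n
covering-length (suc v) l covers with remove l (covers v ≤-refl)
... | l' , len , rest rewrite len =
  s≤s (covering-length v l' λ w w<v → rest w (covers w (m<n⇒m<1+n w<v)) (<⇒≢ w<v))

mexAux-spec : ∀ fuel m l v → m ≤ v → v ≤ m + fuel →
  (∀ w → m ≤ w → w < v → w ∈ l) → v ∉ l → mexAux fuel m l ≡ v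
mexAux-spec zero m l v m≤v v≤m _ _ = ≤-antisym m≤v (subst (v ≤_) (+-identityʳ m) v≤m)
mexAux-spec (suc fuel) m l v m≤v v≤ below v∉l with m ∈? l
... | yes m∈l = mexAux-spec fuel (suc m) l v
                  (≤∧≢⇒< m≤v λ m≡v → v∉l (subst (_∈ l) m≡v m∈l))
                  (subst (v ≤_) (+-suc m fuel) v≤)
                  (λ w m<w → below w (<⇒≤ m<w)) v∉l
... | no m∉l with m <? v
...   | yes m<v = ⊥-elim (m∉l (below m ≤-refl m<v))
...   | no m≮v  = ≤-antisym m≤v (≮⇒≥ m≮v)

mex-spec : ∀ l v → (∀ w → w < v → w ∈ l) → v ∉ l → mex l ≡ v
mex-spec l v below v∉l =
  mexAux-spec (length l) 0 l v z≤n (covering-length v l below) (λ w _ → below w) v∉l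

∈-mapMaybe⁻ : ∀ {A B : Set} (g : A → Maybe B) xs {w} → w ∈ mapMaybe g xs →
  Σ A λ x → x ∈ xs × g x ≡ just w
∈-mapMaybe⁻ g (x ∷ xs) w∈ with g x in gx
∈-mapMaybe⁻ g (x ∷ xs) (here refl) | just _ = x , here refl , gx
∈-mapMaybe⁻ g (x ∷ xs) (there w∈) | just _ with ∈-mapMaybe⁻ g xs w∈
... | y , y∈xs , gy = y , there y∈xs , gy
∈-mapMaybe⁻ g (x ∷ xs) w∈ | nothing with ∈-mapMaybe⁻ g xs w∈
... | y , y∈xs , gy = y , there y∈xs , gy

∈-mapMaybe⁺ : ∀ {A B : Set} (g : A → Maybe B) xs {x w} →
  x ∈ xs → g x ≡ just w → w ∈ mapMaybe g xs
∈-mapMaybe⁺ g (x ∷ xs) (here refl) gx rewrite gx = here refl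
∈-mapMaybe⁺ g (y ∷ xs) (there x∈xs) gx with g y
... | just _  = there (∈-mapMaybe⁺ g xs x∈xs gx)
... | nothing = ∈-mapMaybe⁺ g xs x∈xs gx

-- history f n = [f (n-1), …, f 0]: the shape of `table S n` when G = f.
history : (ℕ → ℕ) → ℕ → List ℕ
history f zero    = []
history f (suc n) = f n ∷ history f n

index-history : ∀ f i m → index (history f (suc i + m)) i ≡ just (f m)
index-history f zero    m = refl
index-history f (suc i) m = index-history f i m

index-history-beyond : ∀ f n i → n ≤ i → index (history f n) i ≡ nothing
index-history-beyond f zero    i       _         = refl
index-history-beyond f (suc n) (suc i) (s≤s n≤i) = index-history-beyond f n i n≤i

OptionValue : List ℕ → (ℕ → ℕ) → ℕ → ℕ → Set
OptionValue S f n w = Σ ℕ λ s → s ∈ S × 0 < s × Σ ℕ λ m → n ≡ s + m × f m ≡ w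

options-sound : ∀ S f n {w} → w ∈ options S (history f n) → OptionValue S f n w
options-sound S f n w∈ with ∈-mapMaybe⁻ _ S w∈
... | suc i , s∈S , pick≡ with split n (suc i)
...   | inj₁ n≤i rewrite index-history-beyond f n i (≤-pred n≤i) = case pick≡ of λ ()
...   | inj₂ (m , refl) rewrite index-history f i m =
  suc i , s∈S , s≤s z≤n , m , refl , just-injective pick≡

options-complete : ∀ S f n {w} → OptionValue S f n w → w ∈ options S (history f n)
options-complete S f n (suc i , s∈S , _ , m , refl , fm≡w) =
  ∈-mapMaybe⁺ _ S s∈S (trans (index-history f i m) (cong just fm≡w))

nim-sequence-unique : ∀ S (f : ℕ → ℕ) →
  (∀ n w → w < f n → OptionValue S f n w) →
  (∀ s m → s ∈ S → 0 < s → f (s + m) ≢ f m) →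
  ∀ n → G S n ≡ f n
nim-sequence-unique S f reach avoid n =
  trans (cong (λ t → mex (options S t)) (table≡history n)) (mex-options n)
  where
  mex-options : ∀ n → mex (options S (history f n)) ≡ f n
  mex-options n = mex-spec _ (f n)
    (λ w w<fn → options-complete S f n (reach n w w<fn))
    (λ fn∈ → excluded (options-sound S f n fn∈))
    where
    excluded : ¬ OptionValue S f n (f n)
    excluded (s , s∈S , 0<s , m , refl , fm≡fn) = avoid s m s∈S 0<s (sym fm≡fn)

  table≡history : ∀ n → table S n ≡ history f n
  table≡history zero    = refl
  table≡history (suc n) rewrite table≡history n = cong (_∷ history f n) (mex-options n)

Periodic : (ℕ → ℕ) → ℕ → Set
Periodic f p = ∀ n q → f (n + q * p) ≡ f n

Collides : (ℕ → ℕ) → ℕ → Set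
Collides f t = Σ ℕ λ n → f (n + t) ≡ f n

module PeriodicSequence {f : ℕ → ℕ} {p : ℕ} (periodic : Periodic f p) where

  periodic-once : ∀ n → f (n + p) ≡ f n
  periodic-once n = trans (cong (λ q → f (n + q)) (sym (+-identityʳ p))) (periodic n 1)

  collides-mod : ∀ t q → Collides f (t + q * p) ⇔ Collides f t
  collides-mod t q = mk⇔
    (λ (n , e) → n , trans (sym (shift n)) e)
    (λ (n , e) → n , trans (shift n) e)
    where
    shift : ∀ n → f (n + (t + q * p)) ≡ f (n + t)
    shift n = trans (cong f (sym (+-assoc n t (q * p)))) (periodic (n + t) q)

  collides-reflect : ∀ {t t'} → t' + t ≡ p → Collides f t' → Collides f t
  collides-reflect {t} {t'} t'+t≡p (n , e) = n + t' , (begin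
    f (n + t' + t)  ≡⟨ cong f (trans (+-assoc n t' t) (cong (n +_) t'+t≡p)) ⟩
    f (n + p)       ≡⟨ periodic-once n ⟩
    f n             ≡⟨ sym e ⟩
    f (n + t')      ∎)
    where open ≡-Reasoning

  module _ .{{_ : NonZero p}} where

    reduce : ∀ n → Σ ℕ λ y → Σ ℕ λ q → y < p × n ≡ y + q * p
    reduce n = n % p , n / p , m%n<n n p , m≡m%n+[m/n]*n n p

    no-collision-from-period : ∀ t → (∀ y → y < p → f (y + t) ≢ f y) → ¬ Collides f t
    no-collision-from-period t none (n , e) with reduce n
    ... | y , q , y<p , refl = none y y<p (begin
      f (y + t)              ≡⟨ sym (periodic (y + t) q) ⟩
      f (y + t + q * p)      ≡⟨ cong f (+-assoc y t (q * p)) ⟩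
      f (y + (t + q * p))    ≡⟨ cong (λ x → f (y + x)) (+-comm t (q * p)) ⟩
      f (y + (q * p + t))    ≡⟨ cong f (sym (+-assoc y (q * p) t)) ⟩
      f (y + q * p + t)      ≡⟨ e ⟩
      f (y + q * p)          ≡⟨ periodic y q ⟩
      f y                    ∎)
      where open ≡-Reasoning

    reach-from-period : ∀ S → (∀ y → y < p → ∀ w → w < f y → OptionValue S f y w) →
      ∀ n w → w < f n → OptionValue S f n w
    reach-from-period S reach n w w<fn with reduce n
    ... | y , q , y<p , refl with reach y y<p w (subst (w <_) (periodic y q) w<fn)
    ...   | s , s∈S , 0<s , m , refl , fm≡w =
      s , s∈S , 0<s , m + q * p , +-assoc s m (q * p) , trans (periodic m q) fm≡w

expansion-of-periodic : ∀ S (f : ℕ → ℕ) p .{{_ : NonZero p}} (Base : ℕ → Set) →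
  (∀ n → G S n ≡ f n) → Periodic f p →
  (∀ x → Base x → ¬ Collides f x) →
  (∀ t → t < p → Base t ⊎ Collides f t) →
  ∀ s → (InExpansion S s → Star Base p s) × (Star Base p s → InExpansion S s)
expansion-of-periodic S f p Base G≡f periodic base-free residues s = into , from
  where
  open PeriodicSequence periodic

  G-collision : ∀ {t} → Collides f t → Σ ℕ λ n → G S (n + t) ≡ G S n
  G-collision {t} (n , e) = n , trans (G≡f (n + t)) (trans e (sym (G≡f n)))

  into : InExpansion S s → Star Base p s
  into (_ , no-G-collision) with reduce s
  ... | t , q , t<p , refl with residues t t<p
  ...   | inj₁ base-t    = t , q , base-t , refl
  ...   | inj₂ collision with G-collision (Equivalence.from (collides-mod t q) collision)
  ...     | n , e = ⊥-elim (no-G-collision n e)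

  from : Star Base p s → InExpansion S s
  from (x , m , base-x , refl) = positive x base-x , no-G-collision
    where
    positive : ∀ x → Base x → 1 ≤ x + m * p
    positive zero    base-0 = ⊥-elim (base-free 0 base-0 (0 , refl))
    positive (suc x) _      = s≤s z≤n

    no-G-collision : ∀ n → G S (n + (x + m * p)) ≢ G S n
    no-G-collision n e = base-free x base-x (Equivalence.to (collides-mod x m)
      (n , trans (sym (G≡f _)) (trans e (G≡f n))))

parity-suc : ∀ n → parity (suc n) ≡ parity n ⁻¹
parity-suc n = sym (ℙ.⁻¹-selfInverse (ℙ.suc-homo-⁻¹ n))

parity-+-odd : ∀ i s → parity s ≡ 1ℙ → parity (i + s) ≡ parity i ⁻¹
parity-+-odd i s odd-s rewrite +-comm i s | ℙ.+-homo-+ s i | odd-s = refl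

odd⇒parity : ∀ {s} → Odd s → parity s ≡ 1ℙ
odd⇒parity (j , refl) rewrite parity-suc (2 * j) | ℙ.*-homo-* 2 j = refl

parity⇒odd : ∀ s → parity s ≡ 1ℙ → Odd s
parity⇒odd (suc zero)    _ = 0 , refl
parity⇒odd (suc (suc s)) odd-s with parity⇒odd s odd-s
... | j , refl = suc j , cong (λ m → suc (suc m)) (sym (+-suc j (j + 0)))

even-before-odd : ∀ i → parity (suc i) ≡ 1ℙ → parity i ≡ 0ℙ
even-before-odd i odd-suc-i = ℙ.⁻¹-injective (trans (sym (parity-suc i)) odd-suc-i)

even-after-odd : ∀ i → parity i ≡ 1ℙ → parity (suc i) ≡ 0ℙ
even-after-odd i odd-i = trans (parity-suc i) (cong _⁻¹ odd-i)

both-parities : ∀ i {P : Parity → Set} → P (parity i) → P (parity (suc i)) → ∀ π → P π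
both-parities i {P} at-i at-suc-i π with parity i in parity-i | π
... | 0ℙ | 0ℙ = at-i
... | 1ℙ | 1ℙ = at-i
... | 0ℙ | 1ℙ = subst P (trans (parity-suc i) (cong _⁻¹ parity-i)) at-suc-i
... | 1ℙ | 0ℙ = subst P (even-after-odd i parity-i) at-suc-i

odd-complement : ∀ {k s} → parity k ≡ 1ℙ → parity s ≡ 1ℙ → s ≤ k →
  Σ ℕ λ e → parity e ≡ 1ℙ × e ≤ k × s + e ≡ suc k
odd-complement {k} {suc s'} odd-k odd-s s≤k with m≤n⇒∃[o]m+o≡n s≤k
... | e' , s+e'≡k = suc e' , odd-e , e≤k , trans (+-suc (suc s') e') (cong suc s+e'≡k)
  where
  odd-e : parity (suc e') ≡ 1ℙ
  odd-e = ℙ.⁻¹-injective (begin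
    parity (suc e') ⁻¹                ≡⟨ sym (parity-+-odd (suc e') (suc s') odd-s) ⟩
    parity (suc e' + suc s')          ≡⟨ cong parity (+-comm (suc e') (suc s')) ⟩
    parity (suc s' + suc e')          ≡⟨ cong parity (+-suc (suc s') e') ⟩
    parity (suc (suc s' + e'))        ≡⟨ cong (parity ∘ suc) s+e'≡k ⟩
    parity (suc k)                    ≡⟨ parity-suc k ⟩
    parity k ⁻¹                       ≡⟨ cong _⁻¹ odd-k ⟩
    1ℙ ⁻¹                             ∎)
    where open ≡-Reasoning
  e≤k : suc e' ≤ k
  e≤k = subst (suc e' ≤_) s+e'≡k (s≤s (m≤n+m e' s'))

-- The nim values of the sequence constructed below: a zone contributes 0 or 2,
-- a parity contributes 0 or 1.

data Zone : Set where
  low high : Zone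

bit : Parity → ℕ
bit 0ℙ = 0
bit 1ℙ = 1

nimValue : Zone → Parity → ℕ
nimValue low  π = bit π
nimValue high π = 2 + bit π

zoneOf : ℕ → Zone
zoneOf zero          = low
zoneOf (suc zero)    = low
zoneOf (suc (suc _)) = high

zoneOf-nimValue : ∀ z π → zoneOf (nimValue z π) ≡ z
zoneOf-nimValue low  0ℙ = refl
zoneOf-nimValue low  1ℙ = refl
zoneOf-nimValue high π  = refl

parity-nimValue : ∀ z π → parity (nimValue z π) ≡ π
parity-nimValue low  0ℙ = refl
parity-nimValue low  1ℙ = refl
parity-nimValue high 0ℙ = refl
parity-nimValue high 1ℙ = refl

nimValues-differ : ∀ z z' {x y π π'} → x ≡ nimValue z π → y ≡ nimValue z' π' →
  ¬ (z ≡ z' × π ≡ π') → x ≢ y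
nimValues-differ z z' {π = π} {π'} refl refl different x≡y = different
  ( trans (sym (zoneOf-nimValue z π)) (trans (cong zoneOf x≡y) (zoneOf-nimValue z' π'))
  , trans (sym (parity-nimValue z π)) (trans (cong parity x≡y) (parity-nimValue z' π')) )

below-nimValue : ∀ z π w → w < nimValue z π →
  (z ≡ high × Σ Parity λ π' → w ≡ nimValue low π') ⊎ (π ≡ 1ℙ × w ≡ nimValue z 0ℙ)
below-nimValue low  1ℙ 0 _ = inj₂ (refl , refl)
below-nimValue high π  0 _ = inj₁ (refl , 0ℙ , refl)
below-nimValue high π  1 _ = inj₁ (refl , 1ℙ , refl)
below-nimValue high 1ℙ 2 _ = inj₂ (refl , refl)
below-nimValue high 0ℙ (suc (suc w)) (s≤s (s≤s ()))
below-nimValue high 1ℙ (suc (suc (suc w))) (s≤s (s≤s (s≤s ())))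
below-nimValue low  0ℙ w ()
below-nimValue low  1ℙ (suc w) (s≤s ())

-- With L = (k+1)·a and period p = b + L, one period consists of
--   the low zone  [0, L):     blocks i ≤ k of length a with value parity i,
--   the high zone L + [0, b): blocks j ≤ k (the last one of length r)
--                             with value 2 + parity j.
module NimSequence (a k r : ℕ) .{{_ : NonZero a}}
  (odd-k : parity k ≡ 1ℙ) (0<r : 0 < r) (r<a : r < a) where

  -- Arithmetic identities below are stated with b, L and p unfolded, so
  -- that the ring solver (which treats defined names as opaque) can check them.
  b L p : ℕ
  b = k * a + r
  L = suc k * a
  p = b + L

  S : List ℕ
  S = a ∷ b ∷ (a + b) ∷ []

  0<a : 0 < a
  0<a = >-nonZero⁻¹ a

  instance
    p-nonZero : NonZero p
    p-nonZero = >-nonZero (<-≤-trans 0<r (≤-trans (m≤n+m r (k * a)) (m≤m+n b L)))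

  profile : ℕ → ℕ
  profile y with y <? L
  ... | yes _ = nimValue low  (parity (y / a))
  ... | no  _ = nimValue high (parity ((y ∸ L) / a))

  f : ℕ → ℕ
  f n = profile (n % p)

  f-periodic : Periodic f p
  f-periodic n q = cong profile ([m+kn]%n≡m%n n q p)

  open PeriodicSequence f-periodic

  f-low-zone : ∀ {x} → x < L → f x ≡ nimValue low (parity (x / a))
  f-low-zone {x} x<L rewrite m<n⇒m%n≡m (<-≤-trans x<L (m≤n+m L b)) with x <? L
  ... | yes _   = refl
  ... | no  x≮L = ⊥-elim (x≮L x<L)

  f-high-zone : ∀ {x} → x < b → f (L + x) ≡ nimValue high (parity (x / a))
  f-high-zone {x} x<b rewrite m<n⇒m%n≡m (subst (L + x <_) (+-comm L b) (+-monoʳ-< L x<b))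
    with L + x <? L
  ... | yes L+x<L = ⊥-elim (<-irrefl refl (≤-<-trans (m≤m+n L x) L+x<L))
  ... | no  _     = cong (λ y → nimValue high (parity (y / a))) (m+n∸m≡n L x)

  b<L : b < L
  b<L = subst (b <_) (+-comm (k * a) a) (+-monoʳ-< (k * a) r<a)

  block-below : ∀ {i j u} → u < a → i < j → i * a + u < j * a
  block-below {i} {j} {u} u<a i<j = begin-strict
    i * a + u  <⟨ +-monoʳ-< (i * a) u<a ⟩
    i * a + a  ≡⟨ +-comm (i * a) a ⟩
    suc i * a  ≤⟨ *-monoˡ-≤ a i<j ⟩
    j * a      ∎
    where open ≤-Reasoning

  block-index : ∀ {i j u} → i * a + u < j * a → i < j
  block-index {i} {j} {u} lt = *-cancelʳ-< a i j (≤-<-trans (m≤m+n (i * a) u) lt)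

  block-div : ∀ i {u} → u < a → (i * a + u) / a ≡ i
  block-div i {u} u<a = begin
    (i * a + u) / a    ≡⟨ +-distrib-/-∣ˡ u (divides i refl) ⟩
    i * a / a + u / a  ≡⟨ cong₂ _+_ (m*n/n≡m i a) (m<n⇒m/n≡0 u<a) ⟩
    i + 0              ≡⟨ +-identityʳ i ⟩
    i                  ∎
    where open ≡-Reasoning

  divide : ∀ x → Σ ℕ λ i → Σ ℕ λ u → u < a × x ≡ i * a + u
  divide x = x / a , x % a , m%n<n x a , trans (m≡m%n+[m/n]*n x a) (+-comm (x % a) _)

  f-low : ∀ {i u} → i ≤ k → u < a → f (i * a + u) ≡ nimValue low (parity i)
  f-low {i} i≤k u<a rewrite f-low-zone (block-below u<a (s≤s i≤k)) | block-div i u<a = refl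

  f-high : ∀ j {u} → j * a + u < b → u < a → f (L + (j * a + u)) ≡ nimValue high (parity j)
  f-high j x<b u<a rewrite f-high-zone x<b | block-div j u<a = refl

  f-first-low : ∀ {v} → v < a → f v ≡ nimValue low 0ℙ
  f-first-low = f-low z≤n

  f-last-low : ∀ {v} → v < a → f (k * a + v) ≡ nimValue low 1ℙ
  f-last-low v<a = trans (f-low ≤-refl v<a) (cong (nimValue low) odd-k)

  f-first-high : ∀ {v} → v < r → f (L + v) ≡ nimValue high 0ℙ
  f-first-high v<r = f-high 0 (<-≤-trans v<r (m≤n+m r (k * a))) (<-trans v<r r<a)

  f-last-high : ∀ {v} → v < r → f (L + (k * a + v)) ≡ nimValue high 1ℙ
  f-last-high v<r = trans (f-high k (+-monoʳ-< (k * a) v<r) (<-trans v<r r<a)) (cong (nimValue high) odd-k)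

  InZone : Zone → ℕ → Set
  InZone z x = Σ Parity λ π → f x ≡ nimValue z π

  in-low : ∀ {x} → x < L → InZone low x
  in-low x<L = _ , f-low-zone x<L

  in-high : ∀ {x} → x < b → InZone high (L + x)
  in-high x<b = _ , f-high-zone x<b

  zones-differ : ∀ {x y} → InZone low x → InZone high y → f x ≢ f y
  zones-differ (_ , fx) (_ , fy) = nimValues-differ low high fx fy λ ()

  data Position (y : ℕ) : Set where
    low-block  : ∀ i u → i ≤ k → u < a → y ≡ i * a + u → Position y
    high-block : ∀ j u → j * a + u < b → u < a → y ≡ L + (j * a + u) → Position y

  low-or-high : ∀ y → y < p → y < L ⊎ Σ ℕ λ x → x < b × y ≡ L + x
  low-or-high y y<p with split y L
  ... | inj₁ y<L       = inj₁ y<L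
  ... | inj₂ (x , refl) = inj₂ (x , +-cancelˡ-< L x b (subst (L + x <_) (+-comm b L) y<p) , refl)

  low-position : ∀ y → y < L → Position y
  low-position y y<L with divide y
  ... | i , u , u<a , refl = low-block i u (≤-pred (block-index y<L)) u<a refl

  position : ∀ y → y < p → Position y
  position y y<p with low-or-high y y<p
  ... | inj₁ y<L = low-position y y<L
  ... | inj₂ (x , x<b , refl) with divide x
  ...   | j , u , u<a , refl = high-block j u x<b u<a refl

  parities-differ : ∀ z {x y π} → f x ≡ nimValue z (π ⁻¹) → f y ≡ nimValue z π → f x ≢ f y
  parities-differ z {π = π} fx fy =
    nimValues-differ z z fx fy λ (_ , π⁻¹≡π) → ℙ.p≢p⁻¹ π (sym π⁻¹≡π)

  -- Shifting by an odd multiple s·a with s ≤ k changes the value of f.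
  -- From a low block the shift lands in a block of opposite parity or in
  -- the high zone.
  odd-shift-low : ∀ {s i u} → parity s ≡ 1ℙ → s ≤ k → i ≤ k → u < a →
    f (i * a + u + s * a) ≢ f (i * a + u)
  odd-shift-low {s} {i} {u} odd-s s≤k i≤k u<a with split (i + s) (suc k)
  ... | inj₁ i+s≤k = parities-differ low shifted (f-low i≤k u<a)
    where
    regroup : i * a + u + s * a ≡ (i + s) * a + u
    regroup = solve (i ∷ u ∷ s ∷ a ∷ [])
    shifted : f (i * a + u + s * a) ≡ nimValue low (parity i ⁻¹)
    shifted = begin
      f (i * a + u + s * a)          ≡⟨ cong f regroup ⟩
      f ((i + s) * a + u)            ≡⟨ f-low (≤-pred i+s≤k) u<a ⟩
      nimValue low (parity (i + s))  ≡⟨ cong (nimValue low) (parity-+-odd i s odd-s) ⟩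
      nimValue low (parity i ⁻¹)     ∎
      where open ≡-Reasoning
  ... | inj₂ (e , i+s≡k+1+e) = ≢-sym (zones-differ (in-low (block-below u<a (s≤s i≤k)))
          (subst (InZone high) (sym wraps) (in-high (<-≤-trans (block-below u<a e<k) (m≤m+n (k * a) r)))))
    where
    wraps : i * a + u + s * a ≡ suc k * a + (e * a + u)
    wraps = transfer (cong (_* a) i+s≡k+1+e) (solve (i ∷ u ∷ s ∷ e ∷ k ∷ a ∷ []))
    e<k : e < k
    e<k = +-cancelˡ-≤ k (suc e) k (begin
      k + suc e    ≡⟨ +-suc k e ⟩
      suc k + e    ≡⟨ sym i+s≡k+1+e ⟩
      i + s        ≤⟨ +-mono-≤ i≤k s≤k ⟩
      k + k        ∎)
      where open ≤-Reasoning

  same-value : ∀ {x x' y} → f x ≡ f x' → f x' ≢ f y → f x ≢ f y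
  same-value fx≡fx' fx'≢fy fx≡fy = fx'≢fy (trans (sym fx≡fx') fx≡fy)

  -- From a high block the shift lands in a high block of opposite parity or
  -- wraps around into the low zone of the next period.
  odd-shift-high : ∀ {s j u} → parity s ≡ 1ℙ → s ≤ k → j * a + u < b → u < a →
    f (L + (j * a + u) + s * a) ≢ f (L + (j * a + u))
  odd-shift-high {s} {j} {u} odd-s s≤k x<b u<a with split (j * a + u + s * a) (k * a + r)
  ... | inj₁ moved<b = parities-differ high shifted (f-high j x<b u<a)
    where
    regroup : j * a + u + s * a ≡ (j + s) * a + u
    regroup = solve (j ∷ u ∷ s ∷ a ∷ [])
    shifted : f (L + (j * a + u) + s * a) ≡ nimValue high (parity j ⁻¹)
    shifted = begin
      f (L + (j * a + u) + s * a)          ≡⟨ cong f (trans (+-assoc L _ _) (cong (L +_) regroup)) ⟩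
      f (L + ((j + s) * a + u))            ≡⟨ f-high (j + s) (subst (_< b) regroup moved<b) u<a ⟩
      nimValue high (parity (j + s))       ≡⟨ cong (nimValue high) (parity-+-odd j s odd-s) ⟩
      nimValue high (parity j ⁻¹)          ∎
      where open ≡-Reasoning
  ... | inj₂ (z , moved≡b+z) =
    same-value (trans (cong f wraps) (periodic-once z)) (zones-differ (in-low z<L) (in-high x<b))
    where
    wraps : suc k * a + (j * a + u) + s * a ≡ z + (k * a + r + suc k * a)
    wraps = transfer moved≡b+z (solve (k ∷ j ∷ u ∷ s ∷ a ∷ z ∷ r ∷ []))
    z<L : z < L
    z<L = begin-strict
      z      <⟨ +-cancelˡ-< b z (s * a) (subst (_< b + s * a) moved≡b+z (+-monoˡ-< (s * a) x<b)) ⟩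
      s * a  ≤⟨ *-monoˡ-≤ a (m≤n⇒m≤1+n s≤k) ⟩
      L      ∎
      where open ≤-Reasoning

  odd-multiple-free : ∀ {s} → parity s ≡ 1ℙ → s ≤ k → ¬ Collides f (s * a)
  odd-multiple-free odd-s s≤k = no-collision-from-period _ λ y y<p → case position y y<p of λ where
    (low-block i u i≤k u<a refl)   → odd-shift-low odd-s s≤k i≤k u<a
    (high-block j u x<b u<a refl) → odd-shift-high {j = j} odd-s s≤k x<b u<a

  -- From the low zone: a landing point in the low zone comes from block 0
  -- and lies in block k; a landing point in the next period lies in block 0
  -- and comes from block k.
  middle-shift-low : ∀ {d y} → d < r + a → y < L → f (y + (k * a + suc d)) ≢ f y
  middle-shift-low {d} {y} d<r+a y<L with split (y + (k * a + suc d)) (suc k * a)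
  ... | inj₁ lands-low = parities-differ low last-block (f-first-low y<a)
    where
    regroup : y + (k * a + suc d) ≡ k * a + (y + suc d)
    regroup = solve (y ∷ k ∷ a ∷ d ∷ [])
    offset<a : y + suc d < a
    offset<a = +-cancelˡ-< (k * a) _ a (subst₂ _<_ regroup (+-comm a (k * a)) lands-low)
    y<a : y < a
    y<a = ≤-<-trans (m≤m+n y (suc d)) offset<a
    last-block : f (y + (k * a + suc d)) ≡ nimValue low 1ℙ
    last-block = trans (cong f regroup) (f-last-low offset<a)
  ... | inj₂ (z , lands≡L+z) with split z (k * a + r)
  ...   | inj₁ z<b = same-value (cong f lands≡L+z) (≢-sym (zones-differ (in-low y<L) (in-high z<b)))
  ...   | inj₂ (z' , z≡b+z') with m≤n⇒∃[o]m+o≡n d<r+a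
  ...     | g , gap = parities-differ low wrapped-first-block (trans (cong f y-last) (f-last-low v<a))
    where
    y-last : y ≡ k * a + (g + z')
    y-last = transfer lands≡L+z (transfer z≡b+z' (transfer (sym gap)
      (solve (y ∷ k ∷ a ∷ d ∷ z ∷ z' ∷ r ∷ g ∷ []))))
    v<a : g + z' < a
    v<a = +-cancelˡ-< (k * a) _ a (subst₂ _<_ y-last (+-comm a (k * a)) y<L)
    wraps : y + (k * a + suc d) ≡ z' + (k * a + r + suc k * a)
    wraps = transfer lands≡L+z (transfer z≡b+z' (solve (y ∷ k ∷ a ∷ d ∷ z ∷ z' ∷ r ∷ [])))
    wrapped-first-block : f (y + (k * a + suc d)) ≡ nimValue low (1ℙ ⁻¹)
    wrapped-first-block =
      trans (cong f wraps) (trans (periodic-once z') (f-first-low (≤-<-trans (m≤n+m z' g) v<a)))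

  -- From the high zone: a landing point in the high zone comes from block 0
  -- and lies in block k; a landing point in the high zone of the next period
  -- lies in block 0 and comes from block k.
  middle-shift-high : ∀ {d x} → d < r + a → x < b → f (L + x + (k * a + suc d)) ≢ f (L + x)
  middle-shift-high {d} {x} d<r+a x<b with split (x + (k * a + suc d)) (k * a + r)
  ... | inj₁ lands-high = parities-differ high last-block (f-first-high x<r)
    where
    regroup : x + (k * a + suc d) ≡ k * a + (x + suc d)
    regroup = solve (x ∷ k ∷ a ∷ d ∷ [])
    offset<r : x + suc d < r
    offset<r = +-cancelˡ-< (k * a) _ r (subst (_< b) regroup lands-high)
    x<r : x < r
    x<r = ≤-<-trans (m≤m+n x (suc d)) offset<r
    last-block : f (L + x + (k * a + suc d)) ≡ nimValue high 1ℙ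
    last-block = trans (cong f (trans (+-assoc L x _) (cong (L +_) regroup))) (f-last-high offset<r)
  ... | inj₂ (z , lands≡b+z) with split z (suc k * a)
  ...   | inj₁ z<L =
    same-value (trans (cong f wraps) (periodic-once z)) (zones-differ (in-low z<L) (in-high x<b))
    where
    wraps : suc k * a + x + (k * a + suc d) ≡ z + (k * a + r + suc k * a)
    wraps = transfer lands≡b+z (solve (x ∷ k ∷ a ∷ d ∷ z ∷ r ∷ []))
  ...   | inj₂ (z' , z≡L+z') with m≤n⇒∃[o]m+o≡n d<r+a
  ...     | g , gap =
    parities-differ high wrapped-first-block (trans (cong (λ y → f (L + y)) x-last) (f-last-high v<r))
    where
    x-last : x ≡ k * a + (g + z')
    x-last = transfer lands≡b+z (transfer z≡L+z' (transfer (sym gap)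
      (solve (x ∷ k ∷ a ∷ d ∷ z ∷ z' ∷ r ∷ g ∷ []))))
    v<r : g + z' < r
    v<r = +-cancelˡ-< (k * a) _ r (subst (_< b) x-last x<b)
    wraps : suc k * a + x + (k * a + suc d) ≡ suc k * a + z' + (k * a + r + suc k * a)
    wraps = transfer lands≡b+z (transfer z≡L+z' (solve (x ∷ k ∷ a ∷ d ∷ z ∷ z' ∷ r ∷ [])))
    wrapped-first-block : f (L + x + (k * a + suc d)) ≡ nimValue high (1ℙ ⁻¹)
    wrapped-first-block =
      trans (cong f wraps) (trans (periodic-once (L + z')) (f-first-high (≤-<-trans (m≤n+m z' g) v<r)))

  middle-free : ∀ {d} → d < r + a → ¬ Collides f (k * a + suc d)
  middle-free d<r+a = no-collision-from-period _ λ y y<p → case low-or-high y y<p of λ where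
    (inj₁ y<L)             → middle-shift-low d<r+a y<L
    (inj₂ (x , x<b , refl)) → middle-shift-high d<r+a x<b

  -- Odd multiples reflected through the period: b + s·a = p - e·a with e odd.
  reflected-free : ∀ {s} → parity s ≡ 1ℙ → s ≤ k → ¬ Collides f (b + s * a)
  reflected-free {s} odd-s s≤k collision with odd-complement odd-k odd-s s≤k
  ... | e , odd-e , e≤k , s+e≡k+1 = odd-multiple-free odd-e e≤k (collides-reflect sums-to-p collision)
    where
    sums-to-p : k * a + r + s * a + e * a ≡ k * a + r + suc k * a
    sums-to-p = transfer (cong (_* a) s+e≡k+1) (solve (k ∷ a ∷ r ∷ s ∷ e ∷ []))

  base-free : ∀ x → Base a b k x → ¬ Collides f x
  base-free x (inj₁ (s , odd-s , s≤k , refl)) = odd-multiple-free (odd⇒parity odd-s) s≤k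
  base-free x (inj₂ (inj₂ (s , odd-s , s≤k , refl))) = reflected-free (odd⇒parity odd-s) s≤k
  base-free x (inj₂ (inj₁ (ka<x , x≤b+a))) with m≤n⇒∃[o]m+o≡n ka<x
  ... | d , refl = subst (¬_ ∘ Collides f) (sym (+-assoc (k * a) 1 d)) (middle-free d<r+a)
    where
    d<r+a : d < r + a
    d<r+a = +-cancelˡ-≤ (k * a) (suc d) (r + a)
      (subst₂ _≤_ (+-assoc (k * a) 1 d) (+-assoc (k * a) r a) x≤b+a)

  even-block-collision : ∀ {i u} → parity i ≡ 0ℙ → i ≤ k → u < a → Collides f (i * a + u)
  even-block-collision even-i i≤k u<a =
    0 , trans (f-low i≤k u<a) (trans (cong (nimValue low) even-i) (sym (f-first-low 0<a)))

  -- In an odd block i < k with 0 < u < a, the shift from a - u lands on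
  -- (i+1)·a, and both positions have value 0.
  odd-block-collision : ∀ {i u} → parity i ≡ 1ℙ → i < k → 0 < u → u < a → Collides f (i * a + u)
  odd-block-collision {i} {suc u'} odd-i i<k _ u<a with m≤n⇒∃[o]m+o≡n u<a
  ... | g , gap = suc g , (begin
    f (suc g + (i * a + suc u'))     ≡⟨ cong f lands ⟩
    f (suc i * a + 0)                ≡⟨ f-low i<k 0<a ⟩
    nimValue low (parity (suc i))    ≡⟨ cong (nimValue low) (even-after-odd i odd-i) ⟩
    nimValue low 0ℙ                  ≡⟨ sym (f-first-low g+1<a) ⟩
    f (suc g)                        ∎)
    where
    open ≡-Reasoning
    lands : suc g + (i * a + suc u') ≡ suc i * a + 0
    lands = transfer gap (solve (g ∷ i ∷ a ∷ u' ∷ []))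
    g+1<a : suc g < a
    g+1<a = subst (suc g <_) gap (s≤s (s≤s (m≤n+m g u')))

  OddMultiple : ℕ → Set
  OddMultiple t = Σ ℕ λ s → parity s ≡ 1ℙ × s ≤ k × t ≡ s * a

  low-block-residue : ∀ {i} u → i ≤ k → u < a → i * a + u ≤ k * a →
    OddMultiple (i * a + u) ⊎ Collides f (i * a + u)
  low-block-residue {i} u i≤k u<a t≤ka with parity i in parity-i
  low-block-residue u        i≤k u<a t≤ka | 0ℙ = inj₂ (even-block-collision parity-i i≤k u<a)
  low-block-residue {i} zero i≤k u<a t≤ka | 1ℙ = inj₁ (i , parity-i , i≤k , +-identityʳ (i * a))
  low-block-residue {i} (suc u') i≤k u<a t≤ka | 1ℙ =
    inj₂ (odd-block-collision {i} parity-i i<k (s≤s z≤n) u<a)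
    where
    i<k : i < k
    i<k = block-index {u = u'} (subst (_≤ k * a) (+-suc (i * a) u') t≤ka)

  low-residue : ∀ t → t ≤ k * a → OddMultiple t ⊎ Collides f t
  low-residue t t≤ka with divide t
  ... | i , u , u<a , refl =
    low-block-residue u i≤k u<a t≤ka
    where
    i≤k : i ≤ k
    i≤k = ≤-pred (block-index {i} {suc k} {u} (≤-<-trans t≤ka (m<n+m (k * a) 0<a)))

  -- Distances t > b + a are reflections t = p - t' of distances t' ≤ k·a.
  high-residue : ∀ {t t'} → t' + t ≡ k * a + r + suc k * a → t' ≤ k * a →
    Base a b k t ⊎ Collides f t
  high-residue {t} {t'} t'+t≡p t'≤ka with low-residue t' t'≤ka
  ... | inj₂ collision = inj₂ (collides-reflect t'+t≡p collision)
  ... | inj₁ (s , odd-s , s≤k , refl) with odd-complement odd-k odd-s s≤k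
  ...   | e , odd-e , e≤k , s+e≡k+1 = inj₁ (inj₂ (inj₂ (e , parity⇒odd e odd-e , e≤k , t≡b+ea)))
    where
    t≡b+ea : t ≡ k * a + r + e * a
    t≡b+ea = transfer t'+t≡p (transfer (sym (cong (_* a) s+e≡k+1))
      (solve (t ∷ k ∷ a ∷ r ∷ s ∷ e ∷ [])))

  residues : ∀ t → t < p → Base a b k t ⊎ Collides f t
  residues t t<p with split t (suc (k * a))
  ... | inj₁ t≤ka with low-residue t (≤-pred t≤ka)
  ...   | inj₁ (s , odd-s , s≤k , t≡sa) = inj₁ (inj₁ (s , parity⇒odd s odd-s , s≤k , t≡sa))
  ...   | inj₂ collision               = inj₂ collision
  residues t t<p | inj₂ (z , refl) with split (suc (k * a) + z) (suc (k * a + r + a))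
  ... | inj₁ t≤b+a = inj₁ (inj₂ (inj₁ (ka+1≤t , ≤-pred t≤b+a)))
    where
    ka+1≤t : k * a + 1 ≤ suc (k * a) + z
    ka+1≤t = subst (_≤ suc (k * a) + z) (+-comm 1 (k * a)) (m≤m+n (suc (k * a)) z)
  ... | inj₂ (z' , t≡b+a+1+z') with m≤n⇒∃[o]m+o≡n t<p
  ...   | d , gap = high-residue reflection (subst (suc d ≤_) t'-gap (m≤m+n (suc d) (suc z')))
    where
    reflection : suc d + (suc (k * a) + z) ≡ k * a + r + suc k * a
    reflection = trans (+-comm (suc d) _) (trans (+-suc _ d) gap)
    t'-gap : suc d + suc z' ≡ k * a
    t'-gap = transfer gap (transfer (sym t≡b+a+1+z') (solve (d ∷ z' ∷ k ∷ a ∷ r ∷ z ∷ [])))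

  Option : ℕ → ℕ → Set
  Option = OptionValue S f

  move-a : ∀ {y w} m → y ≡ a + m → f m ≡ w → Option y w
  move-a m y≡a+m fm≡w = a , here refl , 0<a , m , y≡a+m , fm≡w

  move-b : ∀ {y w} m → y ≡ b + m → f m ≡ w → Option y w
  move-b m y≡b+m fm≡w =
    b , there (here refl) , <-≤-trans 0<r (m≤n+m r (k * a)) , m , y≡b+m , fm≡w

  move-ab : ∀ {y w} m → y ≡ (a + b) + m → f m ≡ w → Option y w
  move-ab m y≡a+b+m fm≡w =
    a + b , there (there (here refl)) , <-≤-trans 0<a (m≤m+n a b) , m , y≡a+b+m , fm≡w

  -- In an odd block, the move a reaches the preceding even block.
  reach-previous-low : ∀ {i u} → parity i ≡ 1ℙ → i ≤ k → u < a →
    Option (i * a + u) (nimValue low 0ℙ)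
  reach-previous-low {suc i} {u} odd-i i<k u<a =
    move-a (i * a + u) (+-assoc a (i * a) u)
      (trans (f-low (≤-trans (n≤1+n i) i<k) u<a) (cong (nimValue low) (even-before-odd i odd-i)))

  reach-previous-high : ∀ {j u} → parity j ≡ 1ℙ → j * a + u < b → u < a →
    Option (L + (j * a + u)) (nimValue high 0ℙ)
  reach-previous-high {suc j} {u} odd-j x<b u<a =
    move-a (L + (j * a + u)) one-block-back
      (trans (f-high j (≤-<-trans (+-monoˡ-≤ u (m≤n+m (j * a) a)) x<b) u<a)
             (cong (nimValue high) (even-before-odd j odd-j)))
    where
    one-block-back : suc k * a + (suc j * a + u) ≡ a + (suc k * a + (j * a + u))
    one-block-back = solve (k ∷ a ∷ j ∷ u ∷ [])

  -- From a high position, two moves reach consecutive low blocks: b and a + b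
  -- in general, a and b from the first high block when u < r.
  consecutive-low-options : ∀ j {u} → j * a + u < b → u < a → Σ ℕ λ i →
      Option (L + (j * a + u)) (nimValue low (parity i))
    × Option (L + (j * a + u)) (nimValue low (parity (suc i)))
  consecutive-low-options j {u} x<b u<a with split u r | m≤n⇒∃[o]m+o≡n r<a
  ... | inj₂ (v , refl) | _ =
    j , move-ab (j * a + v) via-ab (f-low (<⇒≤ j<k) v<a) , move-b (suc j * a + v) via-b (f-low j<k v<a)
    where
    v<a : v < a
    v<a = ≤-<-trans (m≤n+m v r) u<a
    regroup : j * a + (r + v) ≡ j * a + v + r
    regroup = solve (j ∷ a ∷ r ∷ v ∷ [])
    j<k : j < k
    j<k = block-index {u = v} (+-cancelʳ-< r _ (k * a) (subst (_< b) regroup x<b))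
    via-ab : suc k * a + (j * a + (r + v)) ≡ a + (k * a + r) + (j * a + v)
    via-ab = solve (k ∷ a ∷ j ∷ r ∷ v ∷ [])
    via-b : suc k * a + (j * a + (r + v)) ≡ k * a + r + (suc j * a + v)
    via-b = solve (k ∷ a ∷ j ∷ r ∷ v ∷ [])
  consecutive-low-options zero {u} x<b u<a | inj₁ u<r | h , gap =
    k , move-a (k * a + u) via-a (f-low ≤-refl u<a)
      , move-b (u + suc h) via-b
          (trans (f-first-low c<a) (cong (nimValue low) (sym (even-after-odd k odd-k))))
    where
    c<a : u + suc h < a
    c<a = subst (u + suc h <_) (trans (+-suc r h) gap) (+-monoˡ-< (suc h) u<r)
    via-a : suc k * a + u ≡ a + (k * a + u)
    via-a = solve (k ∷ a ∷ u ∷ [])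
    via-b : suc k * a + u ≡ k * a + r + (u + suc h)
    via-b = transfer (sym gap) (solve (k ∷ a ∷ u ∷ r ∷ h ∷ []))
  consecutive-low-options (suc j) {u} x<b u<a | inj₁ u<r | h , gap =
    j , move-ab (j * a + (u + suc h)) via-ab (f-low (<⇒≤ j<k) c<a)
      , move-b (suc j * a + (u + suc h)) via-b (f-low j<k c<a)
    where
    c<a : u + suc h < a
    c<a = subst (u + suc h <_) (trans (+-suc r h) gap) (+-monoˡ-< (suc h) u<r)
    j<k : j < k
    j<k = ≤-pred (block-index {suc j} {suc k} {u} (<-trans x<b b<L))
    via-ab : suc k * a + (suc j * a + u) ≡ a + (k * a + r) + (j * a + (u + suc h))
    via-ab = transfer (sym gap) (solve (k ∷ a ∷ j ∷ u ∷ r ∷ h ∷ []))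
    via-b : suc k * a + (suc j * a + u) ≡ k * a + r + (suc j * a + (u + suc h))
    via-b = transfer (sym gap) (solve (k ∷ a ∷ j ∷ u ∷ r ∷ h ∷ []))

  reach : ∀ y → y < p → ∀ w → w < f y → Option y w
  reach y y<p w w<fy with position y y<p
  ... | low-block i u i≤k u<a refl
    with below-nimValue low (parity i) w (subst (w <_) (f-low i≤k u<a) w<fy)
  ...   | inj₂ (odd-i , refl) = reach-previous-low odd-i i≤k u<a
  reach y y<p w w<fy | high-block j u x<b u<a refl
    with below-nimValue high (parity j) w (subst (w <_) (f-high j x<b u<a) w<fy)
  ...   | inj₂ (odd-j , refl)    = reach-previous-high {j} odd-j x<b u<a
  ...   | inj₁ (_ , π , refl) with consecutive-low-options j x<b u<a
  ...     | i , at-i , at-suc-i = both-parities i {λ π → Option _ (nimValue low π)} at-i at-suc-i π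

  0<k : 0 < k
  0<k = n≢0⇒n>0 λ k≡0 → case trans (cong parity (sym k≡0)) odd-k of λ ()

  moves-in-base : ∀ s → s ∈ S → Base a b k s
  moves-in-base s (here refl) = inj₁ (1 , (0 , refl) , 0<k , sym (+-identityʳ a))
  moves-in-base s (there (here refl)) = inj₂ (inj₁ (+-monoʳ-≤ (k * a) 0<r , m≤m+n b a))
  moves-in-base s (there (there (here refl))) =
    inj₂ (inj₁ (≤-trans (+-monoʳ-≤ (k * a) 0<r) (m≤n+m b a) , ≤-reflexive (+-comm a b)))

  G≡f : ∀ n → G S n ≡ f n
  G≡f = nim-sequence-unique S f (reach-from-period S reach) avoid
    where
    avoid : ∀ s m → s ∈ S → 0 < s → f (s + m) ≢ f m
    avoid s m s∈S _ e = base-free s (moves-in-base s s∈S) (m , trans (cong f (+-comm m s)) e)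

  expansion : ∀ s → (InExpansion S s → Star (Base a b k) p s)
                  × (Star (Base a b k) p s → InExpansion S s)
  expansion = expansion-of-periodic S f p (Base a b k) G≡f f-periodic base-free residues

-- The hypotheses 2 ≤ a and a < b are implied by 0 < r < a and k ≥ 1.
theorem4p1 : ∀ (a b k r : ℕ) → 2 ≤ a → a < b → Odd k → 0 < r → r < a →
    b ≡ k * a + r →
    ∀ s → (InExpansion (a ∷ b ∷ (a + b) ∷ []) s → Star (Base a b k) (b + (k + 1) * a) s)
        × (Star (Base a b k) (b + (k + 1) * a) s → InExpansion (a ∷ b ∷ (a + b) ∷ []) s)
theorem4p1 a .(k * a + r) k r _ _ odd-k 0<r r<a refl s =
  subst (λ p → (InExpansion S s → Star (Base a b k) p s) × (Star (Base a b k) p s → InExpansion S s))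
        period (expansion s)
  where
  open NimSequence a k r ⦃ >-nonZero (<-trans 0<r r<a) ⦄ (odd⇒parity odd-k) 0<r r<a
  period : p ≡ b + (k + 1) * a
  period = cong (λ m → b + m * a) (+-comm 1 k)
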